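{- Let $p>r$ be positive integers and let $x\ge y\ge z$ be positive integers with $x,y,z\notin\{p,r\}$. (i) If $K_{x,y,z}$ has the same Seidel spectrum as $K_{p,p,r}$, then $x>p>y\ge z>r$ and $x+y<2p$. (ii) If $K_{x,y,z}$ has the same Seidel spectrum as $K_{p,r,r}$, then $p>x\ge y>r>z$ and $x+y<2p$.
   Context: All graphs are finite and simple. For a graph $G$, the Seidel matrix is $S(G)=J-I-2A(G)$, where $A(G)$ is the adjacency matrix, $J$ the all-ones matrix and $I$ the identity; the Seidel spectrum of $G$ is the multiset of eigenvalues of $S(G)$. $K_{a,b,c}$ denotes the complete tripartite graph with parts of sizes $a,b,c$. -}

module Defs where

open import Data.Nat as ℕ using (ℕ; zero; suc; _<ᵇ_; _≡ᵇ_)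
open import Data.Integer as ℤ using (ℤ; +_; -_; _-_)
open import Data.Fin using (Fin; zero; suc; toℕ; punchIn)
open import Data.Bool using (Bool; true; false; if_then_else_; not)
open import Relation.Binary.PropositionalEquality using (_≡_)

Mat : ℕ → Set
Mat n = Fin n → Fin n → ℤ

Graph : ℕ → Set
Graph n = Fin n → Fin n → Bool

eqFin : ∀ {n} → Fin n → Fin n → Bool
eqFin zero zero = true
eqFin zero (suc _) = false
eqFin (suc _) zero = false
eqFin (suc i) (suc j) = eqFin i j

ind : Bool → ℤ
ind true = + 1
ind false = + 0

adjMat : ∀ {n} → Graph n → Mat n
adjMat G i j = ind (G i j)

idMat : ∀ {n} → Mat n
idMat i j = ind (eqFin i j)

seidel : ∀ {n} → Graph n → Mat n
seidel G i j = (+ 1 - idMat i j) - (+ 2 ℤ.* adjMat G i j)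

minor : ∀ {n} → Mat (suc n) → Fin (suc n) → Mat n
minor M j r c = M (suc r) (punchIn j c)

sign : ℕ → ℤ
sign zero = + 1
sign (suc k) = - sign k

sumFin : ∀ {m} → (Fin m → ℤ) → ℤ
sumFin {zero} f = + 0
sumFin {suc m} f = f zero ℤ.+ sumFin (λ k → f (suc k))

det : ∀ {n} → Mat n → ℤ
det {zero} M = + 1
det {suc n} M = sumFin (λ j → sign (toℕ j) ℤ.* (M zero j ℤ.* det (minor M j)))

-- Characteristic polynomial of M, as the polynomial function t ↦ det(tI − M) on ℤ.
-- (A monic integer polynomial is determined by its values on ℤ.)
charPoly : ∀ {n} → Mat n → ℤ → ℤ
charPoly M t = det (λ i j → (t ℤ.* idMat i j) - M i j)

-- Two matrices have the same spectrum (multiset of eigenvalues, with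
-- multiplicities) iff they have the same size and the same characteristic polynomial.
data Cospectral : ∀ {n m} → Mat n → Mat m → Set where
  cosp : ∀ {n} {S T : Mat n} → (∀ t → charPoly S t ≡ charPoly T t) → Cospectral S T

SeidelCospectral : ∀ {n m} → Graph n → Graph m → Set
SeidelCospectral G H = Cospectral (seidel G) (seidel H)

part : (a b : ℕ) → ℕ → ℕ
part a b v = if v <ᵇ a then 0 else (if v <ᵇ a ℕ.+ b then 1 else 2)

K3 : (a b c : ℕ) → Graph (a ℕ.+ b ℕ.+ c)
K3 a b c i j = not (part a b (toℕ i) ℕ.≡ᵇ part a b (toℕ j))

-- Let S be the Seidel matrix of K_{a,b,c}. Moving two vertices of one part to the front, a row
-- operation and two cofactor expansions show that det(−S) is affine in each part size; with the
-- eight cases of part sizes at most 1 this gives det(−S) = 1 − (a + b + c) + 4abc. Seidel-cospectral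
-- graphs have the same order and the same det(−S), so x + y + z and xyz equal the sum and the
-- product of the target triple (d, d, m), where (d, m) = (p, r) in (i) and (d, m) = (r, p) in (ii).
-- Then f(t) = (t − x)(t − y)(t − z) and g(t) = (t − d)²(t − m) differ by κt for a constant κ. As
-- g(v) has the sign of v − m for v ≠ d, the roots x, y, z of f all lie on the side of m given by the
-- sign of κ, and f(d) = −κd has the opposite sign. Comparing x + y + z with 2d + m excludes one side,
-- and the sign of f(d) then places d among x ≥ y ≥ z.
module Submission where

open import Data.Bool using (Bool; true; not)
open import Data.Bool.Properties using (T-≡)
open import Data.Empty using (⊥; ⊥-elim)
open import Data.Fin using (Fin; zero; suc; toℕ; punchIn)
open import Data.Integer as ℤ using (ℤ; +_; -_; -1ℤ)
import Data.Integer.Properties as ℤ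
open import Data.Integer.Tactic.RingSolver using (solve-∀)
open import Data.Nat as ℕ using (ℕ; zero; suc)
import Data.Nat.Properties as ℕ
open import Data.Product using (_×_; _,_; ∃; proj₂; uncurry)
open import Data.Sign as Sign using (Sign)
open import Data.Sum using (_⊎_; inj₁; inj₂)
open import Data.Vec.Functional using (_∷_)
open import Function using (_∘_; flip; case_of_)
open import Function.Bundles using (Equivalence)
open import Relation.Binary using (tri<; tri≈; tri>)
open import Relation.Binary.PropositionalEquality

open import Defs

module Determinant where
  open import Data.Integer using (_+_; _*_; _-_)

  sumFin-cong : ∀ {m} {f g : Fin m → ℤ} → (∀ k → f k ≡ g k) → sumFin f ≡ sumFin g
  sumFin-cong {zero}  f≗g = refl
  sumFin-cong {suc m} f≗g = cong₂ _+_ (f≗g zero) (sumFin-cong (f≗g ∘ suc))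

  sumFin-zero : ∀ {m} {f : Fin m → ℤ} → (∀ k → f k ≡ + 0) → sumFin f ≡ + 0
  sumFin-zero {zero}  f≗0 = refl
  sumFin-zero {suc m} f≗0 = cong₂ _+_ (f≗0 zero) (sumFin-zero (f≗0 ∘ suc))

  sumFin-+ : ∀ {m} (f g : Fin m → ℤ) → sumFin (λ k → f k + g k) ≡ sumFin f + sumFin g
  sumFin-+ {zero}  f g = refl
  sumFin-+ {suc m} f g = trans (cong (_+_ (f zero + g zero)) (sumFin-+ (f ∘ suc) (g ∘ suc)))
                               (interchange (f zero) (g zero) (sumFin (f ∘ suc)) (sumFin (g ∘ suc)))
    where
    interchange : ∀ a b c d → a + b + (c + d) ≡ a + c + (b + d)
    interchange = solve-∀

  sumFin-neg : ∀ {m} (f : Fin m → ℤ) → sumFin (λ k → - f k) ≡ - sumFin f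
  sumFin-neg {zero}  f = refl
  sumFin-neg {suc m} f = trans (cong (_+_ (- f zero)) (sumFin-neg (f ∘ suc)))
                               (sym (ℤ.neg-distrib-+ (f zero) (sumFin (f ∘ suc))))

  sumFin-− : ∀ {m} (f g : Fin m → ℤ) → sumFin (λ k → f k - g k) ≡ sumFin f - sumFin g
  sumFin-− f g = trans (sumFin-+ f (-_ ∘ g)) (cong (_+_ (sumFin f)) (sumFin-neg g))

  sumFin-*ˡ : ∀ {m} a (f : Fin m → ℤ) → sumFin (λ k → a * f k) ≡ a * sumFin f
  sumFin-*ˡ {zero}  a f = sym (ℤ.*-zeroʳ a)
  sumFin-*ˡ {suc m} a f = trans (cong (_+_ (a * f zero)) (sumFin-*ˡ a (f ∘ suc)))
                                (sym (ℤ.*-distribˡ-+ a (f zero) (sumFin (f ∘ suc))))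

  σ : ∀ {n} → Fin n → ℤ
  σ j = sign (toℕ j)

  det-cong : ∀ {n} {M N : Mat n} → (∀ i j → M i j ≡ N i j) → det M ≡ det N
  det-cong {zero}  M≗N = refl
  det-cong {suc n} M≗N = sumFin-cong λ j →
    cong₂ (λ a d → σ j * (a * d)) (M≗N zero j) (det-cong λ r c → M≗N (suc r) (punchIn j c))

  -- Expanding a determinant along rows 0 and 1 gives a sum of this shape (expand₀-pairs), and
  -- exchanging the two rows transposes H: this is where the alternation of det comes from.
  altPairSum : ∀ n → (Fin (suc n) → Fin (suc n) → ℤ) → ℤ
  altPairSum n H = sumFin λ j → σ j * sumFin λ k → σ k * H j (punchIn j k)

  altPairSum-cong : ∀ {n} {H G : Fin (suc n) → Fin (suc n) → ℤ} →
                    (∀ a b → H a b ≡ G a b) → altPairSum n H ≡ altPairSum n G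
  altPairSum-cong H≗G =
    sumFin-cong λ j → cong (σ j *_) (sumFin-cong λ k → cong (σ k *_) (H≗G j (punchIn j k)))

  altPairSum-suc : ∀ n (H : Fin (suc (suc n)) → Fin (suc (suc n)) → ℤ) →
    altPairSum (suc n) H ≡
      sumFin (λ k → σ k * H zero (suc k)) - sumFin (λ j → σ j * H (suc j) zero)
        + altPairSum n (λ a b → H (suc a) (suc b))
  altPairSum-suc n H = begin
    altPairSum (suc n) H
      ≡⟨ cong (_+_ (+ 1 * row₀)) (sumFin-cong peel) ⟩
    + 1 * row₀ + sumFin (λ j → σ j * inner j - σ j * H (suc j) zero)
      ≡⟨ cong (_+_ (+ 1 * row₀)) (sumFin-− (λ j → σ j * inner j) (λ j → σ j * H (suc j) zero)) ⟩
    + 1 * row₀ + (altPairSum n H′ - col₀)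
      ≡⟨ rearrange row₀ (altPairSum n H′) col₀ ⟩
    row₀ - col₀ + altPairSum n H′ ∎
    where
    open ≡-Reasoning
    H′ : Fin (suc n) → Fin (suc n) → ℤ
    H′ a b = H (suc a) (suc b)
    row₀ col₀ : ℤ
    row₀ = sumFin λ k → σ k * H zero (suc k)
    col₀ = sumFin λ j → σ j * H (suc j) zero
    inner : Fin (suc n) → ℤ
    inner j = sumFin λ k → σ k * H′ j (punchIn j k)
    rearrange : ∀ r a c → + 1 * r + (a - c) ≡ r - c + a
    rearrange = solve-∀
    distribute : ∀ s h i → - s * (+ 1 * h + - i) ≡ s * i - s * h
    distribute = solve-∀
    peel : ∀ j → - σ j * (+ 1 * H (suc j) zero + sumFin λ k → - σ k * H′ j (punchIn j k))
               ≡ σ j * inner j - σ j * H (suc j) zero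
    peel j = trans (cong (λ i → - σ j * (+ 1 * H (suc j) zero + i))
                         (trans (sumFin-cong λ k → sym (ℤ.neg-distribˡ-* (σ k) (H′ j (punchIn j k))))
                                (sumFin-neg λ k → σ k * H′ j (punchIn j k))))
                   (distribute (σ j) (H (suc j) zero) (inner j))

  altPairSum-flip : ∀ n H → altPairSum n (flip H) ≡ - altPairSum n H
  altPairSum-flip zero    H = refl
  altPairSum-flip (suc n) H = begin
    altPairSum (suc n) (flip H)    ≡⟨ altPairSum-suc n (flip H) ⟩
    c - r + altPairSum n (flip H′) ≡⟨ cong (_+_ (c - r)) (altPairSum-flip n H′) ⟩
    c - r + - altPairSum n H′      ≡⟨ negate r c (altPairSum n H′) ⟩
    - (r - c + altPairSum n H′)    ≡⟨ cong -_ (altPairSum-suc n H) ⟨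
    - altPairSum (suc n) H         ∎
    where
    open ≡-Reasoning
    H′ = λ a b → H (suc a) (suc b)
    r = sumFin λ k → σ k * H zero (suc k)
    c = sumFin λ j → σ j * H (suc j) zero
    negate : ∀ r c a → c - r + - a ≡ - (r - c + a)
    negate = solve-∀

  i≡-i⇒i≡0 : ∀ {i} → i ≡ - i → i ≡ + 0
  i≡-i⇒i≡0 {+ zero} _ = refl

  altPairSum-symmetric : ∀ n H → (∀ a b → H a b ≡ H b a) → altPairSum n H ≡ + 0
  altPairSum-symmetric n H H-sym = i≡-i⇒i≡0 (trans (altPairSum-cong H-sym) (altPairSum-flip n H))

  expand₀ : ∀ {n} → Mat (suc n) → (Fin (suc n) → ℤ) → ℤ
  expand₀ M v = sumFin λ j → σ j * (v j * det (minor M j))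

  expand₀-cong : ∀ {n} {M N : Mat (suc n)} {u v : Fin (suc n) → ℤ} → (∀ j → u j ≡ v j) →
                 (∀ r c → M (suc r) c ≡ N (suc r) c) → expand₀ M u ≡ expand₀ N v
  expand₀-cong u≗v M≗N = sumFin-cong λ j →
    cong₂ (λ a d → σ j * (a * d)) (u≗v j) (det-cong λ r c → M≗N r (punchIn j c))

  expand₀-+ : ∀ {n} (M : Mat (suc n)) u v → expand₀ M (λ j → u j + v j) ≡ expand₀ M u + expand₀ M v
  expand₀-+ M u v = trans (sumFin-cong λ j → distribute (σ j) (u j) (v j) (det (minor M j)))
                          (sumFin-+ (λ j → σ j * (u j * det (minor M j)))
                                    (λ j → σ j * (v j * det (minor M j))))
    where
    distribute : ∀ s a b d → s * ((a + b) * d) ≡ s * (a * d) + s * (b * d)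
    distribute = solve-∀

  expand₀-single : ∀ {n} (M : Mat (suc n)) a → expand₀ M (a ∷ λ _ → + 0) ≡ a * det (minor M zero)
  expand₀-single M a = begin
    + 1 * (a * d₀) + sumFin (λ j → σ (suc j) * (+ 0 * det (minor M (suc j))))
      ≡⟨ cong (_+_ (+ 1 * (a * d₀))) (sumFin-zero λ j → vanish (σ (suc j)) (det (minor M (suc j)))) ⟩
    + 1 * (a * d₀) + + 0
      ≡⟨ simplify (a * d₀) ⟩
    a * d₀ ∎
    where
    open ≡-Reasoning
    d₀ = det (minor M zero)
    simplify : ∀ x → + 1 * x + + 0 ≡ x
    simplify = solve-∀
    vanish : ∀ s d → s * (+ 0 * d) ≡ + 0
    vanish = solve-∀

  expand₀-pair : ∀ {n} (M : Mat (suc (suc n))) a b →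
                 expand₀ M (a ∷ b ∷ λ _ → + 0) ≡ a * det (minor M zero) - b * det (minor M (suc zero))
  expand₀-pair M a b = begin
    + 1 * (a * d₀) + (-1ℤ * (b * d₁) + sumFin (λ j → σ (suc (suc j)) * (+ 0 * det (minor M (suc (suc j))))))
      ≡⟨ cong (λ z → + 1 * (a * d₀) + (-1ℤ * (b * d₁) + z))
              (sumFin-zero λ j → vanish (σ (suc (suc j))) (det (minor M (suc (suc j))))) ⟩
    + 1 * (a * d₀) + (-1ℤ * (b * d₁) + + 0)
      ≡⟨ simplify (a * d₀) (b * d₁) ⟩
    a * d₀ - b * d₁ ∎
    where
    open ≡-Reasoning
    d₀ = det (minor M zero)
    d₁ = det (minor M (suc zero))
    simplify : ∀ x y → + 1 * x + (-1ℤ * y + + 0) ≡ x - y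
    simplify = solve-∀
    vanish : ∀ s d → s * (+ 0 * d) ≡ + 0
    vanish = solve-∀

  -- skip₂ a b lists the columns other than a and b in increasing order (when a ≢ b).
  skip₂ : ∀ {n} → Fin (suc (suc n)) → Fin (suc (suc n)) → Fin n → Fin (suc (suc n))
  skip₂ zero    zero    c       = suc (suc c)
  skip₂ zero    (suc b) c       = suc (punchIn b c)
  skip₂ (suc a) zero    c       = suc (punchIn a c)
  skip₂ (suc a) (suc b) zero    = zero
  skip₂ (suc a) (suc b) (suc c) = suc (skip₂ a b c)

  skip₂-comm : ∀ {n} (a b : Fin (suc (suc n))) c → skip₂ a b c ≡ skip₂ b a c
  skip₂-comm zero    zero    c       = refl
  skip₂-comm zero    (suc b) c       = refl
  skip₂-comm (suc a) zero    c       = refl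
  skip₂-comm (suc a) (suc b) zero    = refl
  skip₂-comm (suc a) (suc b) (suc c) = cong suc (skip₂-comm a b c)

  punchIn-punchIn : ∀ {n} (j : Fin (suc (suc n))) k c → punchIn j (punchIn k c) ≡ skip₂ j (punchIn j k) c
  punchIn-punchIn zero    k       c       = refl
  punchIn-punchIn (suc j) zero    c       = refl
  punchIn-punchIn (suc j) (suc k) zero    = refl
  punchIn-punchIn (suc j) (suc k) (suc c) = cong suc (punchIn-punchIn j k c)

  minor₂ : ∀ {n} → Mat (suc (suc n)) → Fin (suc (suc n)) → Fin (suc (suc n)) → Mat n
  minor₂ M a b r c = M (suc (suc r)) (skip₂ a b c)

  det-minor₂-comm : ∀ {n} (M : Mat (suc (suc n))) a b → det (minor₂ M a b) ≡ det (minor₂ M b a)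
  det-minor₂-comm M a b = det-cong λ r c → cong (M (suc (suc r))) (skip₂-comm a b c)

  expand₀-pairs : ∀ {n} (M : Mat (suc (suc n))) v →
    expand₀ M v ≡ altPairSum (suc n) (λ a b → v a * M (suc zero) b * det (minor₂ M a b))
  expand₀-pairs M v = sumFin-cong λ j → cong (σ j *_) (begin
    v j * sumFin (λ k → σ k * (M₁ (punchIn j k) * det (minor (minor M j) k)))
      ≡⟨ sumFin-*ˡ (v j) (λ k → σ k * (M₁ (punchIn j k) * det (minor (minor M j) k))) ⟨
    sumFin (λ k → v j * (σ k * (M₁ (punchIn j k) * det (minor (minor M j) k))))
      ≡⟨ sumFin-cong (λ k → trans (reorder (v j) (σ k) (M₁ (punchIn j k)) _)
           (cong (λ d → σ k * (v j * M₁ (punchIn j k) * d))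
                 (det-cong λ r c → cong (M (suc (suc r))) (punchIn-punchIn j k c)))) ⟩
    sumFin (λ k → σ k * (v j * M₁ (punchIn j k) * det (minor₂ M j (punchIn j k)))) ∎)
    where
    open ≡-Reasoning
    M₁ = M (suc zero)
    reorder : ∀ a s b d → a * (s * (b * d)) ≡ s * (a * b * d)
    reorder = solve-∀

  expand₀-row₁ : ∀ {n} (M : Mat (suc (suc n))) → expand₀ M (M (suc zero)) ≡ + 0
  expand₀-row₁ M = trans (expand₀-pairs M (M (suc zero))) (altPairSum-symmetric _ _ λ a b →
    cong₂ _*_ (ℤ.*-comm (M (suc zero) a) (M (suc zero) b)) (det-minor₂-comm M a b))

  adjSwap : ∀ {n} → Fin n → Fin (suc n) → Fin (suc n)
  adjSwap zero    zero          = suc zero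
  adjSwap zero    (suc zero)    = zero
  adjSwap zero    (suc (suc i)) = suc (suc i)
  adjSwap (suc k) zero          = zero
  adjSwap (suc k) (suc i)       = suc (adjSwap k i)

  det-swap₀₁ : ∀ {n} (M : Mat (suc (suc n))) → det (M ∘ adjSwap zero) ≡ - det M
  det-swap₀₁ M = begin
    det (M ∘ adjSwap zero) ≡⟨ expand₀-pairs (M ∘ adjSwap zero) (M (suc zero)) ⟩
    altPairSum _ (λ a b → M (suc zero) a * M zero b * det (minor₂ M a b))
      ≡⟨ altPairSum-cong (λ a b → cong₂ _*_ (ℤ.*-comm (M (suc zero) a) (M zero b))
                                            (det-minor₂-comm M a b)) ⟩
    altPairSum _ (flip H)  ≡⟨ altPairSum-flip _ H ⟩
    - altPairSum _ H       ≡⟨ cong -_ (expand₀-pairs M (M zero)) ⟨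
    - det M                ∎
    where
    open ≡-Reasoning
    H = λ a b → M zero a * M (suc zero) b * det (minor₂ M a b)

  det-swapRows : ∀ {n} (k : Fin n) (M : Mat (suc n)) → det (M ∘ adjSwap k) ≡ - det M
  det-swapRows zero    M = det-swap₀₁ M
  det-swapRows (suc k) M =
    trans (sumFin-cong λ j → trans (cong (λ d → σ j * (M zero j * d)) (det-swapRows k (minor M j)))
                                   (negate (σ j) (M zero j) (det (minor M j))))
          (sumFin-neg λ j → σ j * (M zero j * det (minor M j)))
    where
    negate : ∀ s a d → s * (a * - d) ≡ - (s * (a * d))
    negate = solve-∀

  adjSwap-punchIn : ∀ {n} (k : Fin (suc n)) (j : Fin (suc (suc n))) →
      (σ j ≡ - σ (adjSwap k j) × (∀ c → adjSwap k (punchIn j c) ≡ punchIn (adjSwap k j) c))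
    ⊎ ∃ λ (k′ : Fin n) →
      σ (adjSwap k j) ≡ σ j × (∀ c → adjSwap k (punchIn j c) ≡ punchIn (adjSwap k j) (adjSwap k′ c))
  adjSwap-punchIn zero zero       = inj₁ (refl , λ { zero → refl ; (suc c) → refl })
  adjSwap-punchIn zero (suc zero) = inj₁ (refl , λ { zero → refl ; (suc c) → refl })
  adjSwap-punchIn {suc n} zero (suc (suc j)) =
    inj₂ (zero , refl , λ { zero → refl ; (suc zero) → refl ; (suc (suc c)) → refl })
  adjSwap-punchIn {suc n} (suc k) zero = inj₂ (k , refl , λ c → refl)
  adjSwap-punchIn {suc n} (suc k) (suc j) with adjSwap-punchIn k j
  ... | inj₁ (σ≡ , punch)      = inj₁ (cong -_ σ≡ , λ { zero → refl ; (suc c) → cong suc (punch c) })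
  ... | inj₂ (k′ , σ≡ , punch) = inj₂ (suc k′ , cong -_ σ≡ , λ { zero → refl ; (suc c) → cong suc (punch c) })

  sumFin-adjSwap : ∀ {n} (k : Fin n) (h : Fin (suc n) → ℤ) → sumFin (h ∘ adjSwap k) ≡ sumFin h
  sumFin-adjSwap {suc n} zero    h = swap (h (suc zero)) (h zero) (sumFin λ j → h (suc (suc j)))
    where
    swap : ∀ a b c → a + (b + c) ≡ b + (a + c)
    swap = solve-∀
  sumFin-adjSwap {suc n} (suc k) h = cong (_+_ (h zero)) (sumFin-adjSwap k (h ∘ suc))

  det-swapCols : ∀ {n} (k : Fin n) (M : Mat (suc n)) → det (λ i → M i ∘ adjSwap k) ≡ - det M
  det-swapCols {suc n} k M = begin
    det (λ i → M i ∘ adjSwap k)      ≡⟨ sumFin-cong term ⟩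
    sumFin (λ j → - t (adjSwap k j)) ≡⟨ sumFin-neg (t ∘ adjSwap k) ⟩
    - sumFin (t ∘ adjSwap k)         ≡⟨ cong -_ (sumFin-adjSwap k t) ⟩
    - det M                          ∎
    where
    open ≡-Reasoning
    t : Fin (suc (suc n)) → ℤ
    t j = σ j * (M zero j * det (minor M j))
    negate : ∀ s a d → s * (a * - d) ≡ - (s * (a * d))
    negate = solve-∀
    term : ∀ j → σ j * (M zero (adjSwap k j) * det (minor (λ i → M i ∘ adjSwap k) j)) ≡ - t (adjSwap k j)
    term j with adjSwap k j | adjSwap-punchIn k j
    ... | j′ | inj₁ (σ≡ , punch) =
      trans (cong₂ (λ s d → s * (M zero j′ * d)) σ≡ (det-cong λ r c → cong (M (suc r)) (punch c)))
            (sym (ℤ.neg-distribˡ-* (σ j′) (M zero j′ * det (minor M j′))))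
    ... | j′ | inj₂ (k′ , σ≡ , punch) =
      trans (cong₂ (λ s d → s * (M zero j′ * d)) (sym σ≡)
                   (trans (det-cong λ r c → cong (M (suc r)) (punch c)) (det-swapCols k′ (minor M j′))))
            (negate (σ j′) (M zero j′) (det (minor M j′)))

  det-swapRowsCols : ∀ {n} (k : Fin n) (M : Mat (suc n)) →
                     det (λ i c → M (adjSwap k i) (adjSwap k c)) ≡ det M
  det-swapRowsCols k M = begin
    det (λ i c → M (adjSwap k i) (adjSwap k c)) ≡⟨ det-swapRows k (λ i → M i ∘ adjSwap k) ⟩
    - det (λ i → M i ∘ adjSwap k)               ≡⟨ cong -_ (det-swapCols k M) ⟩
    - - det M                                   ≡⟨ ℤ.neg-involutive (det M) ⟩
    det M                                       ∎
    where open ≡-Reasoning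

module Multipartite where
  open import Data.Integer using (_+_; _*_; _-_)
  open import Algebra.Properties.AbelianGroup ℤ.+-0-abelianGroup using (∙-cancelˡ)
  open Determinant

  multipartite : ∀ {n} → (Fin n → ℕ) → Graph n
  multipartite ℓ i j = not (ℓ i ℕ.≡ᵇ ℓ j)

  seidelEntry : Bool → Bool → ℤ
  seidelEntry diagonal samePart = + 0 * ind diagonal - ((+ 1 - ind diagonal) - + 2 * ind (not samePart))

  negSeidel : ∀ {n} → (Fin n → ℕ) → Mat n
  negSeidel ℓ i j = seidelEntry (eqFin i j) (ℓ i ℕ.≡ᵇ ℓ j)

  eqFin-adjSwap : ∀ {n} (k : Fin n) i j → eqFin (adjSwap k i) (adjSwap k j) ≡ eqFin i j
  eqFin-adjSwap zero    zero          zero          = refl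
  eqFin-adjSwap zero    zero          (suc zero)    = refl
  eqFin-adjSwap zero    zero          (suc (suc j)) = refl
  eqFin-adjSwap zero    (suc zero)    zero          = refl
  eqFin-adjSwap zero    (suc zero)    (suc zero)    = refl
  eqFin-adjSwap zero    (suc zero)    (suc (suc j)) = refl
  eqFin-adjSwap zero    (suc (suc i)) zero          = refl
  eqFin-adjSwap zero    (suc (suc i)) (suc zero)    = refl
  eqFin-adjSwap zero    (suc (suc i)) (suc (suc j)) = refl
  eqFin-adjSwap (suc k) zero          zero          = refl
  eqFin-adjSwap (suc k) zero          (suc j)       = refl
  eqFin-adjSwap (suc k) (suc i)       zero          = refl
  eqFin-adjSwap (suc k) (suc i)       (suc j)       = eqFin-adjSwap k i j

  ≡ᵇ-refl : ∀ m → (m ℕ.≡ᵇ m) ≡ true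
  ≡ᵇ-refl m = Equivalence.to T-≡ (ℕ.≡⇒≡ᵇ m m refl)

  -- Δ is opaque so that equations between values of Δ are checked by comparing the labellings,
  -- not by unfolding determinants of symbolic size.
  opaque
    Δ : ∀ {n} → (Fin n → ℕ) → ℤ
    Δ ℓ = det (negSeidel ℓ)

    Δ-charPoly : ∀ {n} (ℓ : Fin n → ℕ) → Δ ℓ ≡ charPoly (seidel (multipartite ℓ)) (+ 0)
    Δ-charPoly ℓ = refl

    Δ-cong : ∀ {n} {ℓ ℓ′ : Fin n → ℕ} → (∀ i → ℓ i ≡ ℓ′ i) → Δ ℓ ≡ Δ ℓ′
    Δ-cong ℓ≗ℓ′ = det-cong λ i j → cong₂ (λ a b → seidelEntry (eqFin i j) (a ℕ.≡ᵇ b)) (ℓ≗ℓ′ i) (ℓ≗ℓ′ j)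

    Δ-adjSwap : ∀ {n} (k : Fin n) (ℓ ℓ′ : Fin (suc n) → ℕ) → (∀ i → ℓ′ i ≡ ℓ (adjSwap k i)) → Δ ℓ′ ≡ Δ ℓ
    Δ-adjSwap k ℓ ℓ′ ℓ′≗ℓ∘swap = begin
      Δ ℓ′              ≡⟨ Δ-cong ℓ′≗ℓ∘swap ⟩
      Δ (ℓ ∘ adjSwap k) ≡⟨ det-cong (λ i j → cong (λ e → seidelEntry e (ℓ (adjSwap k i) ℕ.≡ᵇ ℓ (adjSwap k j)))
                                                  (eqFin-adjSwap k i j)) ⟨
      det (λ i j → negSeidel ℓ (adjSwap k i) (adjSwap k j))
                        ≡⟨ det-swapRowsCols k (negSeidel ℓ) ⟩
      Δ ℓ               ∎
      where open ≡-Reasoning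

    -- Row 0 is row 1 plus e₀ − e₁, and the minor at (0, 1) differs from the one at (0, 0),
    -- which is Δ (y ∷ ℓ), only in its corner entry.
    Δ-pair₀ : ∀ {n} y (ℓ : Fin n → ℕ) → Δ (y ∷ y ∷ ℓ) ≡ + 2 * Δ (y ∷ ℓ) - Δ ℓ
    Δ-pair₀ {n} y ℓ = begin
      expand₀ M (M zero)                          ≡⟨ expand₀-cong {M = M} {N = M} row₀ (λ _ _ → refl) ⟩
      expand₀ M (λ j → e₀₁ j + M (suc zero) j)    ≡⟨ expand₀-+ M e₀₁ (M (suc zero)) ⟩
      expand₀ M e₀₁ + expand₀ M (M (suc zero))    ≡⟨ cong₂ _+_ (expand₀-pair M (+ 1) -1ℤ) (expand₀-row₁ M) ⟩
      + 1 * Δ (y ∷ ℓ) - -1ℤ * det N + + 0         ≡⟨ cong (λ d → + 1 * Δ (y ∷ ℓ) - -1ℤ * d + + 0) det-N ⟩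
      + 1 * Δ (y ∷ ℓ) - -1ℤ * (-1ℤ * Δ ℓ + Δ (y ∷ ℓ)) + + 0
                                                  ≡⟨ simplify (Δ (y ∷ ℓ)) (Δ ℓ) ⟩
      + 2 * Δ (y ∷ ℓ) - Δ ℓ                       ∎
      where
      open ≡-Reasoning
      M : Mat (suc (suc n))
      M = negSeidel (y ∷ y ∷ ℓ)
      P N : Mat (suc n)
      P = negSeidel (y ∷ ℓ)
      N = minor M (suc zero)
      e₀₁ : Fin (suc (suc n)) → ℤ
      e₀₁ = + 1 ∷ -1ℤ ∷ λ _ → + 0
      e₀ : Fin (suc n) → ℤ
      e₀ = -1ℤ ∷ λ _ → + 0
      row₀ : ∀ j → M zero j ≡ e₀₁ j + M (suc zero) j
      row₀ zero          rewrite ≡ᵇ-refl y = refl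
      row₀ (suc zero)    rewrite ≡ᵇ-refl y = refl
      row₀ (suc (suc j)) = sym (ℤ.+-identityˡ (M (suc zero) (suc (suc j))))
      row₀ᴺ : ∀ j → N zero j ≡ e₀ j + P zero j
      row₀ᴺ zero    rewrite ≡ᵇ-refl y = refl
      row₀ᴺ (suc j) = sym (ℤ.+-identityˡ (P zero (suc j)))
      rowsᴺ : ∀ r c → N (suc r) c ≡ P (suc r) c
      rowsᴺ r zero    = refl
      rowsᴺ r (suc c) = refl
      det-N : det N ≡ -1ℤ * Δ ℓ + Δ (y ∷ ℓ)
      det-N = begin
        expand₀ N (N zero)                ≡⟨ expand₀-cong {M = N} {N = P} row₀ᴺ rowsᴺ ⟩
        expand₀ P (λ j → e₀ j + P zero j) ≡⟨ expand₀-+ P e₀ (P zero) ⟩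
        expand₀ P e₀ + expand₀ P (P zero) ≡⟨ cong (λ d → d + Δ (y ∷ ℓ)) (expand₀-single P -1ℤ) ⟩
        -1ℤ * Δ ℓ + Δ (y ∷ ℓ)             ∎
      simplify : ∀ a b → + 1 * a - -1ℤ * (-1ℤ * b + a) + + 0 ≡ + 2 * a - b
      simplify = solve-∀

  Δ-swap₀ : ∀ {n} x y (ℓ : Fin n → ℕ) → Δ (x ∷ y ∷ ℓ) ≡ Δ (y ∷ x ∷ ℓ)
  Δ-swap₀ x y ℓ = Δ-adjSwap zero (y ∷ x ∷ ℓ) (x ∷ y ∷ ℓ)
    λ { zero → refl ; (suc zero) → refl ; (suc (suc i)) → refl }

  Δ-swap₁ : ∀ {n} w x y (ℓ : Fin n → ℕ) → Δ (w ∷ x ∷ y ∷ ℓ) ≡ Δ (w ∷ y ∷ x ∷ ℓ)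
  Δ-swap₁ w x y ℓ = Δ-adjSwap (suc zero) (w ∷ y ∷ x ∷ ℓ) (w ∷ x ∷ y ∷ ℓ)
    λ { zero → refl ; (suc zero) → refl ; (suc (suc zero)) → refl ; (suc (suc (suc i))) → refl }

  Δ-swap₂ : ∀ {n} v w x y (ℓ : Fin n → ℕ) → Δ (v ∷ w ∷ x ∷ y ∷ ℓ) ≡ Δ (v ∷ w ∷ y ∷ x ∷ ℓ)
  Δ-swap₂ v w x y ℓ = Δ-adjSwap (suc (suc zero)) (v ∷ w ∷ y ∷ x ∷ ℓ) (v ∷ w ∷ x ∷ y ∷ ℓ)
    λ { zero → refl ; (suc zero) → refl ; (suc (suc zero)) → refl ; (suc (suc (suc zero))) → refl
      ; (suc (suc (suc (suc i)))) → refl }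

  Δ-pair₁ : ∀ {n} x y (ℓ : Fin n → ℕ) → Δ (x ∷ y ∷ y ∷ ℓ) ≡ + 2 * Δ (x ∷ y ∷ ℓ) - Δ (x ∷ ℓ)
  Δ-pair₁ x y ℓ = begin
    Δ (x ∷ y ∷ y ∷ ℓ)               ≡⟨ Δ-swap₀ x y (y ∷ ℓ) ⟩
    Δ (y ∷ x ∷ y ∷ ℓ)               ≡⟨ Δ-swap₁ y x y ℓ ⟩
    Δ (y ∷ y ∷ x ∷ ℓ)               ≡⟨ Δ-pair₀ y (x ∷ ℓ) ⟩
    + 2 * Δ (y ∷ x ∷ ℓ) - Δ (x ∷ ℓ) ≡⟨ cong (λ d → + 2 * d - Δ (x ∷ ℓ)) (Δ-swap₀ y x ℓ) ⟩
    + 2 * Δ (x ∷ y ∷ ℓ) - Δ (x ∷ ℓ) ∎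
    where open ≡-Reasoning

  Δ-pair₂ : ∀ {n} w x y (ℓ : Fin n → ℕ) → Δ (w ∷ x ∷ y ∷ y ∷ ℓ) ≡ + 2 * Δ (w ∷ x ∷ y ∷ ℓ) - Δ (w ∷ x ∷ ℓ)
  Δ-pair₂ w x y ℓ = begin
    Δ (w ∷ x ∷ y ∷ y ∷ ℓ)                   ≡⟨ Δ-swap₁ w x y (y ∷ ℓ) ⟩
    Δ (w ∷ y ∷ x ∷ y ∷ ℓ)                   ≡⟨ Δ-swap₂ w y x y ℓ ⟩
    Δ (w ∷ y ∷ y ∷ x ∷ ℓ)                   ≡⟨ Δ-pair₁ w y (x ∷ ℓ) ⟩
    + 2 * Δ (w ∷ y ∷ x ∷ ℓ) - Δ (w ∷ x ∷ ℓ) ≡⟨ cong (λ d → + 2 * d - Δ (w ∷ x ∷ ℓ)) (Δ-swap₁ w y x ℓ) ⟩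
    + 2 * Δ (w ∷ x ∷ y ∷ ℓ) - Δ (w ∷ x ∷ ℓ) ∎
    where open ≡-Reasoning

  -- The labelling of K3 a b c by parts, built with _∷_ so that Δ-pair₀, Δ-pair₁ and Δ-pair₂
  -- apply to it definitionally.
  blocks : (a b c : ℕ) → Fin (a ℕ.+ b ℕ.+ c) → ℕ
  blocks (suc a) b       c       = 0 ∷ blocks a b c
  blocks zero    (suc b) c       = 1 ∷ blocks zero b c
  blocks zero    zero    (suc c) = 2 ∷ blocks zero zero c
  blocks zero    zero    zero    ()

  part≗blocks : ∀ a b c (i : Fin (a ℕ.+ b ℕ.+ c)) → part a b (toℕ i) ≡ blocks a b c i
  part≗blocks (suc a) b       c       zero    = refl
  part≗blocks (suc a) b       c       (suc i) = part≗blocks a b c i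
  part≗blocks zero    (suc b) c       zero    = refl
  part≗blocks zero    (suc b) c       (suc i) = part≗blocks zero b c i
  part≗blocks zero    zero    (suc c) zero    = refl
  part≗blocks zero    zero    (suc c) (suc i) = part≗blocks zero zero c i

  Δ₃ : ℕ → ℕ → ℕ → ℤ
  Δ₃ a b c = Δ (blocks a b c)

  charPoly-K3 : ∀ a b c → charPoly (seidel (K3 a b c)) (+ 0) ≡ Δ₃ a b c
  charPoly-K3 a b c = trans (sym (Δ-charPoly λ i → part a b (toℕ i))) (Δ-cong (part≗blocks a b c))

  Affine : (ℕ → ℤ) → Set
  Affine f = ∀ n → f (suc (suc n)) ≡ + 2 * f (suc n) - f n

  affine-unique : ∀ {f g} → Affine f → Affine g → f 0 ≡ g 0 → f 1 ≡ g 1 → ∀ n → f n ≡ g n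
  affine-unique af ag f₀≡g₀ f₁≡g₁ zero          = f₀≡g₀
  affine-unique af ag f₀≡g₀ f₁≡g₁ (suc zero)    = f₁≡g₁
  affine-unique {f} {g} af ag f₀≡g₀ f₁≡g₁ (suc (suc n)) = begin
    f (suc (suc n))       ≡⟨ af n ⟩
    + 2 * f (suc n) - f n ≡⟨ cong₂ (λ u v → + 2 * u - v) (f≗g (suc n)) (f≗g n) ⟩
    + 2 * g (suc n) - g n ≡⟨ ag n ⟨
    g (suc (suc n))       ∎
    where
    open ≡-Reasoning
    f≗g = affine-unique {f} {g} af ag f₀≡g₀ f₁≡g₁

  Φ : ℤ → ℤ → ℤ → ℤ
  Φ a b c = + 1 - (a + b + c) + + 4 * (a * b * c)

  -- The ring solver does not unfold Φ, so the identities spell it out; + 2 + + a computes to + (2 + a).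
  Φ-affine₁ : ∀ b c → Affine λ a → Φ (+ a) b c
  Φ-affine₁ b c a = identity (+ a) b c
    where
    identity : ∀ a b c → + 1 - (+ 2 + a + b + c) + + 4 * ((+ 2 + a) * b * c)
                       ≡ + 2 * (+ 1 - (+ 1 + a + b + c) + + 4 * ((+ 1 + a) * b * c))
                         - (+ 1 - (a + b + c) + + 4 * (a * b * c))
    identity = solve-∀

  Φ-affine₂ : ∀ a c → Affine λ b → Φ a (+ b) c
  Φ-affine₂ a c b = identity a (+ b) c
    where
    identity : ∀ a b c → + 1 - (a + (+ 2 + b) + c) + + 4 * (a * (+ 2 + b) * c)
                       ≡ + 2 * (+ 1 - (a + (+ 1 + b) + c) + + 4 * (a * (+ 1 + b) * c))
                         - (+ 1 - (a + b + c) + + 4 * (a * b * c))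
    identity = solve-∀

  Φ-affine₃ : ∀ a b → Affine λ c → Φ a b (+ c)
  Φ-affine₃ a b c = identity a b (+ c)
    where
    identity : ∀ a b c → + 1 - (a + b + (+ 2 + c)) + + 4 * (a * b * (+ 2 + c))
                       ≡ + 2 * (+ 1 - (a + b + (+ 1 + c)) + + 4 * (a * b * (+ 1 + c)))
                         - (+ 1 - (a + b + c) + + 4 * (a * b * c))
    identity = solve-∀

  Δ₃-affine₁ : ∀ b c → Affine λ a → Δ₃ a b c
  Δ₃-affine₁ b c a = Δ-pair₀ 0 (blocks a b c)

  Δ₃-affine₂ : ∀ {a} → a ℕ.≤ 1 → ∀ c → Affine λ b → Δ₃ a b c
  Δ₃-affine₂ ℕ.z≤n         c b = Δ-pair₀ 1 (blocks 0 b c)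
  Δ₃-affine₂ (ℕ.s≤s ℕ.z≤n) c b = Δ-pair₁ 0 1 (blocks 0 b c)

  Δ₃-affine₃ : ∀ {a b} → a ℕ.≤ 1 → b ℕ.≤ 1 → Affine (Δ₃ a b)
  Δ₃-affine₃ ℕ.z≤n         ℕ.z≤n         c = Δ-pair₀ 2 (blocks 0 0 c)
  Δ₃-affine₃ ℕ.z≤n         (ℕ.s≤s ℕ.z≤n) c = Δ-pair₁ 1 2 (blocks 0 0 c)
  Δ₃-affine₃ (ℕ.s≤s ℕ.z≤n) ℕ.z≤n         c = Δ-pair₁ 0 2 (blocks 0 0 c)
  Δ₃-affine₃ (ℕ.s≤s ℕ.z≤n) (ℕ.s≤s ℕ.z≤n) c = Δ-pair₂ 0 1 2 (blocks 0 0 c)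

  opaque
    unfolding Δ

    Δ₃-small : ∀ {a b c} → a ℕ.≤ 1 → b ℕ.≤ 1 → c ℕ.≤ 1 → Δ₃ a b c ≡ Φ (+ a) (+ b) (+ c)
    Δ₃-small ℕ.z≤n         ℕ.z≤n         ℕ.z≤n         = refl
    Δ₃-small ℕ.z≤n         ℕ.z≤n         (ℕ.s≤s ℕ.z≤n) = refl
    Δ₃-small ℕ.z≤n         (ℕ.s≤s ℕ.z≤n) ℕ.z≤n         = refl
    Δ₃-small ℕ.z≤n         (ℕ.s≤s ℕ.z≤n) (ℕ.s≤s ℕ.z≤n) = refl
    Δ₃-small (ℕ.s≤s ℕ.z≤n) ℕ.z≤n         ℕ.z≤n         = refl
    Δ₃-small (ℕ.s≤s ℕ.z≤n) ℕ.z≤n         (ℕ.s≤s ℕ.z≤n) = refl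
    Δ₃-small (ℕ.s≤s ℕ.z≤n) (ℕ.s≤s ℕ.z≤n) ℕ.z≤n         = refl
    Δ₃-small (ℕ.s≤s ℕ.z≤n) (ℕ.s≤s ℕ.z≤n) (ℕ.s≤s ℕ.z≤n) = refl

  Δ₃≡Φ : ∀ a b c → Δ₃ a b c ≡ Φ (+ a) (+ b) (+ c)
  Δ₃≡Φ a b c =
    affine-unique {λ a → Δ₃ a b c} {λ a → Φ (+ a) (+ b) (+ c)} (Δ₃-affine₁ b c) (Φ-affine₁ (+ b) (+ c))
                  (in-b 0≤1 b c) (in-b 1≤1 b c) a
    where
    0≤1 : 0 ℕ.≤ 1
    0≤1 = ℕ.z≤n
    1≤1 : 1 ℕ.≤ 1
    1≤1 = ℕ.s≤s ℕ.z≤n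
    in-c : ∀ {a b} → a ℕ.≤ 1 → b ℕ.≤ 1 → ∀ c → Δ₃ a b c ≡ Φ (+ a) (+ b) (+ c)
    in-c {a} {b} a≤1 b≤1 =
      affine-unique {Δ₃ a b} {λ c → Φ (+ a) (+ b) (+ c)} (Δ₃-affine₃ a≤1 b≤1) (Φ-affine₃ (+ a) (+ b))
                    (Δ₃-small a≤1 b≤1 0≤1) (Δ₃-small a≤1 b≤1 1≤1)
    in-b : ∀ {a} → a ℕ.≤ 1 → ∀ b c → Δ₃ a b c ≡ Φ (+ a) (+ b) (+ c)
    in-b {a} a≤1 b c =
      affine-unique {λ b → Δ₃ a b c} {λ b → Φ (+ a) (+ b) (+ c)} (Δ₃-affine₂ a≤1 c) (Φ-affine₂ (+ a) (+ c))
                    (in-c a≤1 0≤1 c) (in-c a≤1 1≤1 c) b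

  cospectral-size : ∀ {n m} {S : Mat n} {T : Mat m} → Cospectral S T → n ≡ m
  cospectral-size (cosp _) = refl

  cospectral-charPoly : ∀ {n m} {S : Mat n} {T : Mat m} → Cospectral S T → ∀ t → charPoly S t ≡ charPoly T t
  cospectral-charPoly (cosp χS≡χT) = χS≡χT

  Φ-product : ∀ {a b c a′ b′ c′} → a ℕ.+ b ℕ.+ c ≡ a′ ℕ.+ b′ ℕ.+ c′ →
              Φ (+ a) (+ b) (+ c) ≡ Φ (+ a′) (+ b′) (+ c′) → + a * + b * + c ≡ + a′ * + b′ * + c′
  Φ-product {a} {b} {c} {a′} {b′} {c′} sum≡ Φ≡ =
    ℤ.*-cancelˡ-≡ (+ 4) (+ a * + b * + c) (+ a′ * + b′ * + c′)
      (∙-cancelˡ (+ 1 - + (a ℕ.+ b ℕ.+ c)) (+ 4 * (+ a * + b * + c)) (+ 4 * (+ a′ * + b′ * + c′))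
        (trans Φ≡ (cong (λ n → + 1 - + n + + 4 * (+ a′ * + b′ * + c′)) (sym sum≡))))

  K3-cospectral⇒sum-product : ∀ {a b c a′ b′ c′} → SeidelCospectral (K3 a b c) (K3 a′ b′ c′) →
                              a ℕ.+ b ℕ.+ c ≡ a′ ℕ.+ b′ ℕ.+ c′ × + a * + b * + c ≡ + a′ * + b′ * + c′
  K3-cospectral⇒sum-product {a} {b} {c} {a′} {b′} {c′} cs =
    cospectral-size cs , Φ-product {a} {b} {c} {a′} {b′} {c′} (cospectral-size cs) (begin
      Φ (+ a) (+ b) (+ c)                   ≡⟨ Δ₃≡Φ a b c ⟨
      Δ₃ a b c                              ≡⟨ charPoly-K3 a b c ⟨
      charPoly (seidel (K3 a b c)) (+ 0)    ≡⟨ cospectral-charPoly cs (+ 0) ⟩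
      charPoly (seidel (K3 a′ b′ c′)) (+ 0) ≡⟨ charPoly-K3 a′ b′ c′ ⟩
      Δ₃ a′ b′ c′                           ≡⟨ Δ₃≡Φ a′ b′ c′ ⟩
      Φ (+ a′) (+ b′) (+ c′)                ∎)
    where open ≡-Reasoning

module Cubic where
  open import Data.Integer using (_+_; _*_; _-_; +[1+_]; -[1+_])
  open import Algebra.Properties.AbelianGroup ℤ.+-0-abelianGroup using (inverseˡ-unique)

  -- SignOf i s: i is nonzero with sign s (unlike ℤ.sign, which gives 0 the sign +).
  data SignOf : ℤ → Sign → Set where
    positive : ∀ {n} → SignOf +[1+ n ] Sign.+
    negative : ∀ {n} → SignOf -[1+ n ] Sign.-

  SignOf-unique : ∀ {i s t} → SignOf i s → SignOf i t → s ≡ t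
  SignOf-unique positive positive = refl
  SignOf-unique negative negative = refl

  SignOf-opposite : ∀ {i s} → SignOf i s → SignOf i (Sign.opposite s) → ⊥
  SignOf-opposite positive ()
  SignOf-opposite negative ()

  SignOf-* : ∀ {i j s t} → SignOf i s → SignOf j t → SignOf (i * j) (s Sign.* t)
  SignOf-* positive positive = positive
  SignOf-* positive negative = negative
  SignOf-* negative positive = negative
  SignOf-* negative negative = positive

  SignOf-neg : ∀ {i s} → SignOf i s → SignOf (- i) (Sign.opposite s)
  SignOf-neg positive = negative
  SignOf-neg negative = positive

  SignOf-square : ∀ {i s} → SignOf i s → SignOf (i * i) Sign.+
  SignOf-square positive = positive
  SignOf-square negative = positive

  SignOf-cancelˡ : ∀ {i j s} → SignOf j Sign.+ → SignOf (j * i) s → SignOf i s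
  SignOf-cancelˡ {+[1+ m ]}  positive positive = positive
  SignOf-cancelˡ { -[1+ m ]} positive negative = negative
  SignOf-cancelˡ {+ zero} {j} _ j0 with subst (λ i → SignOf i _) (ℤ.*-zeroʳ j) j0
  ... | ()

  SignOf-pos : ∀ {n} → 0 ℕ.< n → SignOf (+ n) Sign.+
  SignOf-pos {suc n} _ = positive

  data Side (v m : ℕ) : Sign → Set where
    below : v ℕ.< m → Side v m Sign.-
    above : m ℕ.< v → Side v m Sign.+

  side-of : ∀ {v m} → v ≢ m → ∃ (Side v m)
  side-of {v} {m} v≢m with ℕ.<-cmp v m
  ... | tri< v<m _ _ = Sign.- , below v<m
  ... | tri≈ _ v≡m _ = ⊥-elim (v≢m v≡m)
  ... | tri> _ _ m<v = Sign.+ , above m<v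

  minus-negative : ∀ {m n} → m ℕ.< n → SignOf (+ m - + n) Sign.-
  minus-negative {m} m<n with ℕ.m≤n⇒∃[o]m+o≡n m<n
  ... | o , refl = subst (λ i → SignOf i Sign.-) (sym (identity (+ m) (+ o))) negative
    where
    identity : ∀ m o → m - (+ 1 + m + o) ≡ - (+ 1 + o)
    identity = solve-∀

  minus-positive : ∀ {m n} → n ℕ.< m → SignOf (+ m - + n) Sign.+
  minus-positive {n = n} n<m with ℕ.m≤n⇒∃[o]m+o≡n n<m
  ... | o , refl = subst (λ i → SignOf i Sign.+) (sym (identity (+ n) (+ o))) positive
    where
    identity : ∀ n o → + 1 + n + o - n ≡ + 1 + o
    identity = solve-∀

  side-sign : ∀ {v m s} → Side v m s → SignOf (+ v - + m) s
  side-sign (below v<m) = minus-negative v<m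
  side-sign (above m<v) = minus-positive m<v

  cubic : ℤ → ℤ → ℤ → ℤ → ℤ
  cubic a b c t = (t - a) * (t - b) * (t - c)

  e₂ : ℤ → ℤ → ℤ → ℤ
  e₂ a b c = a * b + b * c + c * a

  cubic-root₁ : ∀ a b c → cubic a b c a ≡ + 0
  cubic-root₁ a b c = identity a b c
    where
    identity : ∀ a b c → (a - a) * (a - b) * (a - c) ≡ + 0
    identity = solve-∀

  cubic-root₂ : ∀ a b c → cubic a b c b ≡ + 0
  cubic-root₂ a b c = identity a b c
    where
    identity : ∀ a b c → (b - a) * (b - b) * (b - c) ≡ + 0
    identity = solve-∀

  cubic-root₃ : ∀ a b c → cubic a b c c ≡ + 0
  cubic-root₃ a b c = identity a b c
    where
    identity : ∀ a b c → (c - a) * (c - b) * (c - c) ≡ + 0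
    identity = solve-∀

  cubic-expand : ∀ a b c t → cubic a b c t ≡ t * t * t - (a + b + c) * (t * t) + e₂ a b c * t - a * b * c
  cubic-expand a b c t = identity a b c t
    where
    identity : ∀ a b c t → (t - a) * (t - b) * (t - c)
                         ≡ t * t * t - (a + b + c) * (t * t) + (a * b + b * c + c * a) * t - a * b * c
    identity = solve-∀

  cubic-shift : ∀ {a b c a′ b′ c′} → a + b + c ≡ a′ + b′ + c′ → a * b * c ≡ a′ * b′ * c′ →
                ∀ t → cubic a′ b′ c′ t ≡ cubic a b c t + t * (e₂ a′ b′ c′ - e₂ a b c)
  cubic-shift {a} {b} {c} {a′} {b′} {c′} sum≡ prod≡ t = begin
    cubic a′ b′ c′ t
      ≡⟨ cubic-expand a′ b′ c′ t ⟩
    t * t * t - (a′ + b′ + c′) * (t * t) + e₂ a′ b′ c′ * t - a′ * b′ * c′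
      ≡⟨ cong₂ (λ s p → t * t * t - s * (t * t) + e₂ a′ b′ c′ * t - p) sum≡ prod≡ ⟨
    t * t * t - (a + b + c) * (t * t) + e₂ a′ b′ c′ * t - a * b * c
      ≡⟨ regroup t (a + b + c) (a * b * c) (e₂ a b c) (e₂ a′ b′ c′) ⟩
    t * t * t - (a + b + c) * (t * t) + e₂ a b c * t - a * b * c + t * (e₂ a′ b′ c′ - e₂ a b c)
      ≡⟨ cong (λ f → f + t * (e₂ a′ b′ c′ - e₂ a b c)) (cubic-expand a b c t) ⟨
    cubic a b c t + t * (e₂ a′ b′ c′ - e₂ a b c) ∎
    where
    open ≡-Reasoning
    regroup : ∀ t s p e e′ → t * t * t - s * (t * t) + e′ * t - p
                           ≡ t * t * t - s * (t * t) + e * t - p + t * (e′ - e)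
    regroup = solve-∀

  cubic-side : ∀ {x y z t s₁ s₂ s₃} → Side t x s₁ → Side t y s₂ → Side t z s₃ →
               SignOf (cubic (+ x) (+ y) (+ z) (+ t)) (s₁ Sign.* s₂ Sign.* s₃)
  cubic-side tx ty tz = SignOf-* (SignOf-* (side-sign tx) (side-sign ty)) (side-sign tz)

  cubic-negative⇒ : ∀ {x y z t} → z ℕ.≤ y → y ℕ.≤ x → x ≢ t → y ≢ t → z ≢ t →
                    SignOf (cubic (+ x) (+ y) (+ z) (+ t)) Sign.- → t ℕ.< z ⊎ (y ℕ.< t × t ℕ.< x)
  cubic-negative⇒ z≤y y≤x x≢t y≢t z≢t f<0
    with side-of (≢-sym x≢t) | side-of (≢-sym y≢t) | side-of (≢-sym z≢t)
  ... | _ , _            | _ , _            | _ , below t<z    = inj₁ t<z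
  ... | _ , below t<x    | _ , above y<t    | _ , above _      = inj₂ (y<t , t<x)
  ... | _ , above x<t    | _ , below t<y    | _ , above _      = ⊥-elim (ℕ.<-asym x<t (ℕ.<-≤-trans t<y y≤x))
  ... | _ , tx@(above _) | _ , ty@(above _) | _ , tz@(above _) = ⊥-elim (SignOf-opposite (cubic-side tx ty tz) f<0)
  ... | _ , tx@(below _) | _ , ty@(below _) | _ , tz@(above _) = ⊥-elim (SignOf-opposite (cubic-side tx ty tz) f<0)

  cubic-positive⇒ : ∀ {x y z t} → z ℕ.≤ y → y ℕ.≤ x → x ≢ t → y ≢ t → z ≢ t →
                    SignOf (cubic (+ x) (+ y) (+ z) (+ t)) Sign.+ → x ℕ.< t ⊎ (z ℕ.< t × t ℕ.< y)
  cubic-positive⇒ z≤y y≤x x≢t y≢t z≢t f>0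
    with side-of (≢-sym x≢t) | side-of (≢-sym y≢t) | side-of (≢-sym z≢t)
  ... | _ , above x<t    | _ , _            | _ , _            = inj₁ x<t
  ... | _ , below _      | _ , below t<y    | _ , above z<t    = inj₂ (z<t , t<y)
  ... | _ , below _      | _ , above y<t    | _ , below t<z    = ⊥-elim (ℕ.<-asym y<t (ℕ.<-≤-trans t<z z≤y))
  ... | _ , tx@(below _) | _ , ty@(above _) | _ , tz@(above _) = ⊥-elim (SignOf-opposite (cubic-side tx ty tz) f>0)
  ... | _ , tx@(below _) | _ , ty@(below _) | _ , tz@(below _) = ⊥-elim (SignOf-opposite (cubic-side tx ty tz) f>0)

  same-side : ∀ {x y z d m} → x ℕ.+ y ℕ.+ z ≡ d ℕ.+ d ℕ.+ m → + x * + y * + z ≡ + d * + d * + m →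
    0 ℕ.< x → 0 ℕ.< y → 0 ℕ.< z → 0 ℕ.< d → x ≢ d → y ≢ d → z ≢ d → x ≢ m → y ≢ m → z ≢ m →
    ∃ λ s → Side x m s × Side y m s × Side z m s × SignOf (cubic (+ x) (+ y) (+ z) (+ d)) (Sign.opposite s)
  same-side {x} {y} {z} {d} {m} sum≡ prod≡ 0<x 0<y 0<z 0<d x≢d y≢d z≢d x≢m y≢m z≢m
    with side-of x≢m
  ... | s , x-side =
    s , x-side , align (cubic-root₂ X Y Z) 0<y y≢d y≢m , align (cubic-root₃ X Y Z) 0<z z≢d z≢m , f-at-d
    where
    X Y Z D M κ : ℤ
    X = + x
    Y = + y
    Z = + z
    D = + d
    M = + m
    κ = e₂ D D M - e₂ X Y Z
    shift : ∀ t → cubic D D M t ≡ cubic X Y Z t + t * κ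
    shift = cubic-shift (cong +_ sum≡) prod≡
    g-at-root : ∀ {v} → cubic X Y Z (+ v) ≡ + 0 → cubic D D M (+ v) ≡ + v * κ
    g-at-root {v} root = trans (shift (+ v)) (trans (cong (λ f → f + + v * κ) root) (ℤ.+-identityˡ (+ v * κ)))
    g-sign : ∀ {v s} → v ≢ d → Side v m s → SignOf (cubic D D M (+ v)) s
    g-sign v≢d v-side = SignOf-* (SignOf-square (side-sign (proj₂ (side-of v≢d)))) (side-sign v-side)
    κ-sign : ∀ {v s} → cubic X Y Z (+ v) ≡ + 0 → 0 ℕ.< v → v ≢ d → Side v m s → SignOf κ s
    κ-sign root 0<v v≢d v-side =
      SignOf-cancelˡ (SignOf-pos 0<v) (subst (λ i → SignOf i _) (g-at-root root) (g-sign v≢d v-side))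
    κ-sign-x : SignOf κ s
    κ-sign-x = κ-sign (cubic-root₁ X Y Z) 0<x x≢d x-side
    align : ∀ {v} → cubic X Y Z (+ v) ≡ + 0 → 0 ℕ.< v → v ≢ d → v ≢ m → Side v m s
    align root 0<v v≢d v≢m with side-of v≢m
    ... | _ , v-side with SignOf-unique (κ-sign root 0<v v≢d v-side) κ-sign-x
    ... | refl = v-side
    f-at-d : SignOf (cubic X Y Z D) (Sign.opposite s)
    f-at-d = subst (λ i → SignOf i _)
                   (sym (inverseˡ-unique (cubic X Y Z D) (D * κ) (trans (sym (shift D)) (cubic-root₁ D D M))))
                   (SignOf-neg (SignOf-* (SignOf-pos 0<d) κ-sign-x))

open Multipartite using (K3-cospectral⇒sum-product)
open Cubic using (below; above; same-side; cubic-negative⇒; cubic-positive⇒)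
open import Data.Nat using (_<_; _≤_; _>_; _≥_; _+_; _*_)
open ℕ.≤-Reasoning

+-mono₃-< : ∀ {a b c a′ b′ c′} → a < a′ → b < b′ → c < c′ → a + b + c < a′ + b′ + c′
+-mono₃-< a<a′ b<b′ c<c′ = ℕ.+-mono-< (ℕ.+-mono-< a<a′ b<b′) c<c′

2*p≡p+p : ∀ p → 2 * p ≡ p + p
2*p≡p+p p = cong (_+_ p) (ℕ.+-identityʳ p)

ppr-sum-product⇒order : ∀ {p r x y z} → 0 < r → r < p → 0 < z → z ≤ y → y ≤ x →
  x ≢ p → x ≢ r → y ≢ p → y ≢ r → z ≢ p → z ≢ r →
  x + y + z ≡ p + p + r → + x ℤ.* + y ℤ.* + z ≡ + p ℤ.* + p ℤ.* + r →
  x > p × p > y × y ≥ z × z > r × x + y < 2 * p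
ppr-sum-product⇒order {p} {r} {x} {y} {z} 0<r r<p 0<z z≤y y≤x x≢p x≢r y≢p y≢r z≢p z≢r sum≡ prod≡ =
  case same-side {x} {y} {z} {p} {r} sum≡ prod≡ 0<x 0<y 0<z (ℕ.<-trans 0<r r<p) x≢p y≢p z≢p x≢r y≢r z≢r of λ where
    (_ , below x<r , below y<r , below z<r , _) → ⊥-elim (ℕ.<-irrefl sum≡ (begin-strict
      x + y + z  <⟨ +-mono₃-< x<r y<r z<r ⟩
      r + r + r  ≤⟨ ℕ.+-monoˡ-≤ r (ℕ.+-mono-≤ (ℕ.<⇒≤ r<p) (ℕ.<⇒≤ r<p)) ⟩
      p + p + r  ∎))
    (_ , above _ , above _ , above r<z , f[p]<0) →
      case cubic-negative⇒ {x} {y} {z} {p} z≤y y≤x x≢p y≢p z≢p f[p]<0 of λ where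
        (inj₁ p<z) → ⊥-elim (ℕ.<-irrefl (sym sum≡) (begin-strict
          p + p + r  <⟨ ℕ.+-monoʳ-< (p + p) r<p ⟩
          p + p + p  <⟨ +-mono₃-< (ℕ.<-≤-trans p<z (ℕ.≤-trans z≤y y≤x)) (ℕ.<-≤-trans p<z z≤y) p<z ⟩
          x + y + z  ∎))
        (inj₂ (y<p , p<x)) → p<x , y<p , z≤y , r<z , ℕ.+-cancelʳ-< r (x + y) (2 * p) (begin-strict
          x + y + r  <⟨ ℕ.+-monoʳ-< (x + y) r<z ⟩
          x + y + z  ≡⟨ sum≡ ⟩
          p + p + r  ≡⟨ cong (_+ r) (2*p≡p+p p) ⟨
          2 * p + r  ∎)
  where
  0<y = ℕ.<-≤-trans 0<z z≤y
  0<x = ℕ.<-≤-trans 0<y y≤x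

prr-sum-product⇒order : ∀ {p r x y z} → 0 < r → r < p → 0 < z → z ≤ y → y ≤ x →
  x ≢ p → x ≢ r → y ≢ p → y ≢ r → z ≢ p → z ≢ r →
  x + y + z ≡ p + r + r → + x ℤ.* + y ℤ.* + z ≡ + p ℤ.* + r ℤ.* + r →
  p > x × x ≥ y × y > r × r > z × x + y < 2 * p
prr-sum-product⇒order {p} {r} {x} {y} {z} 0<r r<p 0<z z≤y y≤x x≢p x≢r y≢p y≢r z≢p z≢r sum≡ prod≡ =
  case same-side {x} {y} {z} {r} {p} sum≡′ prod≡′ 0<x 0<y 0<z 0<r x≢r y≢r z≢r x≢p y≢p z≢p of λ where
    (_ , above p<x , above p<y , above p<z , _) → ⊥-elim (ℕ.<-irrefl (sym sum≡) (begin-strict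
      p + r + r  <⟨ ℕ.+-monoʳ-< (p + r) r<p ⟩
      p + r + p  <⟨ ℕ.+-monoˡ-< p (ℕ.+-monoʳ-< p r<p) ⟩
      p + p + p  <⟨ +-mono₃-< p<x p<y p<z ⟩
      x + y + z  ∎))
    (_ , below x<p , below y<p , below _ , f[r]>0) →
      case cubic-positive⇒ {x} {y} {z} {r} z≤y y≤x x≢r y≢r z≢r f[r]>0 of λ where
        (inj₁ x<r) → ⊥-elim (ℕ.<-irrefl sum≡ (begin-strict
          x + y + z  <⟨ +-mono₃-< x<r (ℕ.≤-<-trans y≤x x<r) (ℕ.≤-<-trans (ℕ.≤-trans z≤y y≤x) x<r) ⟩
          r + r + r  <⟨ ℕ.+-monoˡ-< r (ℕ.+-monoˡ-< r r<p) ⟩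
          p + r + r  ∎))
        (inj₂ (z<r , r<y)) → x<p , y≤x , r<y , z<r , subst (x + y <_) (sym (2*p≡p+p p)) (ℕ.+-mono-< x<p y<p)
  where
  0<y = ℕ.<-≤-trans 0<z z≤y
  0<x = ℕ.<-≤-trans 0<y y≤x
  sum≡′ : x + y + z ≡ r + r + p
  sum≡′ = trans sum≡ (trans (ℕ.+-assoc p r r) (ℕ.+-comm p (r + r)))
  prod≡′ : + x ℤ.* + y ℤ.* + z ≡ + r ℤ.* + r ℤ.* + p
  prod≡′ = trans prod≡ (trans (ℤ.*-assoc (+ p) (+ r) (+ r)) (ℤ.*-comm (+ p) (+ r ℤ.* + r)))

lemma4p5 : (p r x y z : ℕ) → 0 < r → r < p → 0 < z → z ≤ y → y ≤ x →
    x ≢ p → x ≢ r → y ≢ p → y ≢ r → z ≢ p → z ≢ r →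
    (SeidelCospectral (K3 x y z) (K3 p p r) →
      (x > p × p > y × y ≥ z × z > r × x + y < 2 * p))
    × (SeidelCospectral (K3 x y z) (K3 p r r) →
      (p > x × x ≥ y × y > r × r > z × x + y < 2 * p))
lemma4p5 p r x y z 0<r r<p 0<z z≤y y≤x x≢p x≢r y≢p y≢r z≢p z≢r =
    uncurry (ppr-sum-product⇒order 0<r r<p 0<z z≤y y≤x x≢p x≢r y≢p y≢r z≢p z≢r)
      ∘ K3-cospectral⇒sum-product {x} {y} {z} {p} {p} {r}
  , uncurry (prr-sum-product⇒order 0<r r<p 0<z z≤y y≤x x≢p x≢r y≢p y≢r z≢p z≢r)
      ∘ K3-cospectral⇒sum-product {x} {y} {z} {p} {r} {r}
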